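{- Let $G=(V,E)$ be a control-flow graph with entry $s$ and terminal $t$ as in the context, and let $C\in\mathcal C$ be a valid coverage profile. (a) If $u$ is forward inferable and $X=N^{out}(u)\setminus A(u)$ is the set of successors of $u$ in the forward inference graph, then $C(u)=\top$ if and only if $C(v)=\top$ for some $v\in X$. (b) If $u$ is backward inferable and $X=N^{in}(u)\setminus B(u)$ is the set of successors of $u$ in the backward inference graph, then $C(u)=\top$ if and only if $C(v)=\top$ for some $v\in X$.
   Context: $G=(V,E)$ is a finite directed graph with distinct nodes $s,t$ such that $s$ has in-degree $0$, $t$ has out-degree $0$, every node is reachable from $s$ and every node can reach $t$ by directed paths. $N^{in}(u),N^{out}(u)$ denote in- and out-neighbour sets. An execution trace is a finite collection of (not necessarily simple) directed $s$-$t$ walks; its coverage profile is $C:V\to\{\top,\bot\}$ with $C(u)=\top$ iff $u$ lies on some walk of the trace; $\mathcal C$ is the set of all such profiles. $A(u)$ is the set of nodes reachable from $s$ by a directed path avoiding $u$; $B(u)$ is the set of nodes that can reach $t$ by a directed path avoiding $u$. A node $u$ is forward inferable if $N^{out}(u)\setminus A(u)\neq\emptyset$ and $N^{out}(u)\cap A(u)\cap B(u)=\emptyset$; the forward inference graph is $(V,F)$ with $(u,v)\in F$ iff $u$ is forward inferable and $v\in N^{out}(u)\setminus A(u)$. A node $u$ is backward inferable if $N^{in}(u)\setminus B(u)\neq\emptyset$ and $N^{in}(u)\cap A(u)\cap B(u)=\emptyset$; the backward inference graph is $(V,D)$ with $(u,v)\in D$ iff $u$ is backward inferable and $v\in N^{in}(u)\setminus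 B(u)$. -}

module Defs where

open import Data.Nat using (ℕ)
open import Data.Fin using (Fin)
open import Data.Bool using (Bool; true; T)
open import Data.List using (List)
open import Data.List.Membership.Propositional using (_∈_)
open import Data.Product using (Σ; ∃; _×_)
open import Data.Empty using (⊥)
open import Relation.Nullary using (¬_)
open import Relation.Binary.PropositionalEquality using (_≡_; _≢_)
open import Function.Bundles using (_⇔_)

Graph : ℕ → Set
Graph n = Fin n → Fin n → Bool

module _ {n : ℕ} (G : Graph n) where

  Edge : Fin n → Fin n → Set
  Edge u v = T (G u v)

  data Walk : Fin n → Fin n → Set where
    [_]  : ∀ x → Walk x x
    _∷_  : ∀ {x y z} → Edge x y → Walk y z → Walk x z

  data OnWalk (u : Fin n) : ∀ {x y} → Walk x y → Set where
    on-end  : OnWalk u [ u ]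
    on-head : ∀ {y z} (e : Edge u y) (w : Walk y z) → OnWalk u (e ∷ w)
    on-tail : ∀ {x y z} (e : Edge x y) {w : Walk y z} → OnWalk u w → OnWalk u (e ∷ w)

  data PathAvoiding (w : Fin n) : Fin n → Fin n → Set where
    stop : ∀ {x} → x ≢ w → PathAvoiding w x x
    step : ∀ {x y z} → x ≢ w → Edge x y → PathAvoiding w y z → PathAvoiding w x z

  record IsCFG (s t : Fin n) : Set where
    field
      s≢t        : s ≢ t
      s-no-in    : ∀ u → ¬ Edge u s
      t-no-out   : ∀ v → ¬ Edge t v
      reach-from-s : ∀ u → Walk s u
      reach-to-t   : ∀ u → Walk u t

  module _ (s t : Fin n) where

    InA : Fin n → Fin n → Set
    InA u v = PathAvoiding u s v

    InB : Fin n → Fin n → Set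
    InB u v = PathAvoiding u v t

    Trace : Set
    Trace = List (Walk s t)

    Covered : Trace → Fin n → Set
    Covered tr u = ∃ λ (w : Walk s t) → w ∈ tr × OnWalk u w

    -- C ∈ 𝒞 : C is the coverage profile of some trace (⊤ = true, ⊥ = false)
    ValidProfile : (Fin n → Bool) → Set
    ValidProfile C = ∃ λ (tr : Trace) → ∀ u → (C u ≡ true) ⇔ Covered tr u

    ForwardInferable : Fin n → Set
    ForwardInferable u =
      (∃ λ v → Edge u v × ¬ InA u v) ×
      (∀ v → Edge u v → InA u v → InB u v → ⊥)

    BackwardInferable : Fin n → Set
    BackwardInferable u =
      (∃ λ v → Edge v u × ¬ InB u v) ×
      (∀ v → Edge v u → InA u v → InB u v → ⊥)

    -- forward / backward inference graph edges
    FEdge : Fin n → Fin n → Set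
    FEdge u v = ForwardInferable u × Edge u v × ¬ InA u v

    DEdge : Fin n → Fin n → Set
    DEdge u v = BackwardInferable u × Edge v u × ¬ InB u v

{-# OPTIONS --safe #-}
-- Take a walk of the trace through u.  For (a), after its last visit to u
-- the walk leaves u along an edge u → v and then reaches t avoiding u, so
-- v ∈ B(u); forward inferability then forces v ∉ A(u).  Conversely, if a
-- walk reaches some v ∉ A(u), its prefix from s to v cannot avoid u, so u is
-- covered.  Part (b) is the mirror image, using the first visit to u and the
-- suffix of a walk from v to t.
module Submission where

open import Defs
open import Data.Nat using (ℕ)
open import Data.Fin using (Fin; _≟_)
open import Data.Bool using (Bool; true)
open import Data.Product using (∃; _×_; _,_; map₂)
open import Data.Sum using (_⊎_; inj₁; inj₂)
open import Data.Empty using (⊥-elim)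
open import Relation.Nullary using (¬_; yes; no)
open import Relation.Binary.PropositionalEquality using (_≡_; _≢_; refl)
open import Function.Base using (_∘_)
open import Function.Bundles using (_⇔_; mk⇔; Equivalence)

module _ {n : ℕ} {G : Graph n} where

  _⊆ʷ_ : ∀ {x y x′ y′} → Walk G x′ y′ → Walk G x y → Set
  w′ ⊆ʷ w = ∀ {v} → OnWalk G v w′ → OnWalk G v w

  onWalk-start : ∀ {x y} (w : Walk G x y) → OnWalk G x w
  onWalk-start [ x ]   = on-end
  onWalk-start (e ∷ w) = on-head e w

  prefix : ∀ {x y v} {w : Walk G x y} → OnWalk G v w →
           ∃ λ (p : Walk G x v) → p ⊆ʷ w
  prefix on-end         = [ _ ] , λ o → o
  prefix (on-head e w)  = [ _ ] , λ { on-end → on-head e w }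
  prefix (on-tail e o) with prefix o
  ... | p , p⊆w = e ∷ p , λ { (on-head e _) → on-head e _
                            ; (on-tail e o′) → on-tail e (p⊆w o′) }

  suffix : ∀ {x y v} {w : Walk G x y} → OnWalk G v w →
           ∃ λ (q : Walk G v y) → q ⊆ʷ w
  suffix on-end        = [ _ ] , λ o → o
  suffix (on-head e w) = e ∷ w , λ o → o
  suffix (on-tail e o) with suffix o
  ... | q , q⊆w = q , on-tail e ∘ q⊆w

  visits-or-avoids : ∀ {x y} u (w : Walk G x y) →
                     OnWalk G u w ⊎ PathAvoiding G u x y
  visits-or-avoids u [ x ] with x ≟ u
  ... | yes refl = inj₁ on-end
  ... | no x≢u   = inj₂ (stop x≢u)
  visits-or-avoids u (_∷_ {x = x} e w) with visits-or-avoids u w | x ≟ u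
  ... | inj₁ o  | _        = inj₁ (on-tail e o)
  ... | inj₂ _  | yes refl = inj₁ (on-head e w)
  ... | inj₂ pa | no x≢u   = inj₂ (step x≢u e pa)

  visits-or-avoids-⊆ʷ : ∀ {x y x′ y′} u {w : Walk G x y} (w′ : Walk G x′ y′) →
                        w′ ⊆ʷ w → OnWalk G u w ⊎ PathAvoiding G u x′ y′
  visits-or-avoids-⊆ʷ u w′ w′⊆w with visits-or-avoids u w′
  ... | inj₁ o  = inj₁ (w′⊆w o)
  ... | inj₂ pa = inj₂ pa

  last-exit : ∀ {u x z} {w : Walk G x z} → z ≢ u → OnWalk G u w →
              ∃ λ y → Edge G u y × PathAvoiding G u y z × OnWalk G y w
  last-exit z≢u on-end = ⊥-elim (z≢u refl)
  last-exit {u} z≢u (on-head e w) with visits-or-avoids u w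
  ... | inj₁ o  = map₂ (map₂ (map₂ (on-tail e))) (last-exit z≢u o)
  ... | inj₂ pa = _ , e , pa , on-tail e (onWalk-start w)
  last-exit z≢u (on-tail e o) = map₂ (map₂ (map₂ (on-tail e))) (last-exit z≢u o)

  first-entry : ∀ {u x z} {w : Walk G x z} → x ≢ u → OnWalk G u w →
                ∃ λ y → Edge G y u × PathAvoiding G u x y × OnWalk G y w
  first-entry x≢u on-end        = ⊥-elim (x≢u refl)
  first-entry x≢u (on-head e w) = ⊥-elim (x≢u refl)
  first-entry {u} {x} x≢u (on-tail {y = y} e {w} o) with y ≟ u
  ... | yes refl = x , e , stop x≢u , on-head e w
  ... | no y≢u   = map₂ (map₂ (λ { (pa , o′) → step x≢u e pa , on-tail e o′ }))
                        (first-entry y≢u o)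

module _ {n : ℕ} {G : Graph n} {s t : Fin n} {tr : Trace G s t} where

  covered-iff-forward : ∀ {u} → t ≢ u → ForwardInferable G s t u →
    Covered G s t tr u ⇔
    (∃ λ v → (Edge G u v × ¬ InA G s t u v) × Covered G s t tr v)
  covered-iff-forward {u} t≢u (_ , no-A∩B) = mk⇔ exit enter
    where
    Successor : Set
    Successor = ∃ λ v → (Edge G u v × ¬ InA G s t u v) × Covered G s t tr v
    exit : Covered G s t tr u → Successor
    exit (w , w∈tr , u∈w) with last-exit t≢u u∈w
    ... | v , e , v∈B , v∈w =
      v , (e , λ v∈A → no-A∩B v e v∈A v∈B) , w , w∈tr , v∈w
    enter : Successor → Covered G s t tr u
    enter (v , (_ , v∉A) , w , w∈tr , v∈w) with prefix v∈w
    ... | p , p⊆w with visits-or-avoids-⊆ʷ u p p⊆w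
    ...   | inj₁ u∈w = w , w∈tr , u∈w
    ...   | inj₂ v∈A = ⊥-elim (v∉A v∈A)

  covered-iff-backward : ∀ {u} → s ≢ u → BackwardInferable G s t u →
    Covered G s t tr u ⇔
    (∃ λ v → (Edge G v u × ¬ InB G s t u v) × Covered G s t tr v)
  covered-iff-backward {u} s≢u (_ , no-A∩B) = mk⇔ entry leave
    where
    Predecessor : Set
    Predecessor = ∃ λ v → (Edge G v u × ¬ InB G s t u v) × Covered G s t tr v
    entry : Covered G s t tr u → Predecessor
    entry (w , w∈tr , u∈w) with first-entry s≢u u∈w
    ... | v , e , v∈A , v∈w =
      v , (e , λ v∈B → no-A∩B v e v∈A v∈B) , w , w∈tr , v∈w
    leave : Predecessor → Covered G s t tr u
    leave (v , (_ , v∉B) , w , w∈tr , v∈w) with suffix v∈w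
    ... | q , q⊆w with visits-or-avoids-⊆ʷ u q q⊆w
    ...   | inj₁ u∈w = w , w∈tr , u∈w
    ...   | inj₂ v∈B = ⊥-elim (v∉B v∈B)

  profile-iff : ∀ {C : Fin n → Bool} {X : Fin n → Set} {u} →
    (∀ v → (C v ≡ true) ⇔ Covered G s t tr v) →
    Covered G s t tr u ⇔ (∃ λ v → X v × Covered G s t tr v) →
    (C u ≡ true) ⇔ (∃ λ v → X v × C v ≡ true)
  profile-iff {u = u} C⇔covered iff = mk⇔
    (map₂ (map₂ (from (C⇔covered _))) ∘ to iff ∘ to (C⇔covered u))
    (from (C⇔covered u) ∘ from iff ∘ map₂ (map₂ (to (C⇔covered _))))
    where open Equivalence

lemma3 : ∀ {n : ℕ} (G : Graph n) (s t : Fin n) → IsCFG G s t →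
    (C : Fin n → Bool) → ValidProfile G s t C →
    (∀ u → ForwardInferable G s t u →
      (C u ≡ true) ⇔ (∃ λ v → (Edge G u v × ¬ InA G s t u v) × C v ≡ true)) ×
    (∀ u → BackwardInferable G s t u →
      (C u ≡ true) ⇔ (∃ λ v → (Edge G v u × ¬ InB G s t u v) × C v ≡ true))
lemma3 G s t cfg C (tr , C⇔covered) =
  (λ { u fi@((v , u→v , _) , _) → profile-iff C⇔covered
         (covered-iff-forward (λ { refl → t-no-out v u→v }) fi) }) ,
  (λ { u bi@((v , v→u , _) , _) → profile-iff C⇔covered
         (covered-iff-backward (λ { refl → s-no-in v v→u }) bi) })
  where open IsCFG cfg
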